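{- Let $q$ be a prime power, $d$ a positive divisor of $q+1$, $\epsilon\in\mathbb F_{q^2}^*$ of order $d$, $0\le k<d$, and $A_k=\{x\in\mu_{q+1}:x^{(q+1)/d}=\epsilon^k\}$. Let $L(X)\in\mathbb F_{q^2}[X]$ with $L(0)\ne0$, $\deg L=t<(q+1)/d$, and such that $L$ has no root in $A_k$. (i) Assume there exist an integer $0\le\tau<(q+1)/d$ and $\lambda\in\mu_{q+1}$ such that $\tilde L(x)/L(x)=\lambda x^\tau$ for all $x\in A_k$. Then either $\tau=0$ or $(q+1)/d-t\le\tau\le t$. (ii) When $\tau=0$ (and $\lambda\in\mu_{q+1}$), the identity $\tilde L(x)/L(x)=\lambda x^\tau$ for all $x\in A_k$ holds if and only if $\tilde L(X)=\lambda L(X)$. (iii) When $(q+1)/d-t\le\tau\le t$ (and $\lambda\in\mu_{q+1}$), the identity $\tilde L(x)/L(x)=\lambda x^\tau$ for all $x\in A_k$ holds if and only if $L(X)=P(X)+X^{(q+1)/d-\tau}Q(X)$ for some $P,Q\in\mathbb F_{q^2}[X]$ with $\deg P=t-\tau$, $\tilde P=\lambda P$, $\deg Q=\tau+t-(q+1)/d$, and $\tilde Q=\lambda\epsilon^kQ$.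
   Context: $\mu_{q+1}=\{x\in\mathbb F_{q^2}^*:x^{q+1}=1\}$. For $a\in\mathbb F_{q^2}$ write $\bar a=a^q$. For $f(X)=\sum_{i=0}^na_iX^i\in\mathbb F_{q^2}[X]$ with $a_n\ne0$, define $\tilde f(X)=X^n\bar f(X^{ -1})=\sum_{i=0}^n\bar a_iX^{n-i}$, where $\bar f(X)=\sum_i\bar a_iX^i$. -}

module Defs where

open import Level using (_⊔_)
open import Algebra.Bundles using (CommutativeRing)
open import Data.Nat as ℕ using (ℕ; zero; suc; _∸_; _<_; _≤_; NonZero)
open import Data.Nat.Primality using (Prime)
open import Data.Fin using (Fin; zero; suc; opposite; fromℕ; toℕ)
open import Data.Product using (Σ; ∃; _×_; _,_)
open import Data.Sum using (_⊎_)
open import Relation.Binary.PropositionalEquality using (_≡_)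
open import Relation.Nullary using (¬_; yes; no)
open import Function.Bundles using (_⇔_)

IsPrimePower : ℕ → Set
IsPrimePower q = Σ ℕ λ p → Σ ℕ λ m → Prime p × 1 ≤ m × q ≡ p ℕ.^ m

module FF {c ℓ} (R : CommutativeRing c ℓ) where
  open CommutativeRing R public using (Carrier; _≈_; _+_; _*_; 0#; 1#)

  IsField : Set (c ⊔ ℓ)
  IsField = (¬ (1# ≈ 0#)) × (∀ x → ¬ (x ≈ 0#) → Σ Carrier λ y → (x * y) ≈ 1#)

  HasCard : ℕ → Set (c ⊔ ℓ)
  HasCard n = Σ (Fin n → Carrier) λ e →
                (∀ i j → e i ≈ e j → i ≡ j) × (∀ x → Σ (Fin n) λ i → e i ≈ x)

  pow : Carrier → ℕ → Carrier
  pow x zero    = 1#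
  pow x (suc n) = x * pow x n

  HasOrder : Carrier → ℕ → Set ℓ
  HasOrder ε d = (pow ε d ≈ 1#) × (∀ j → 0 < j → j < d → ¬ (pow ε j ≈ 1#))

  sumF : ∀ {n} → (Fin n → Carrier) → Carrier
  sumF {zero}  f = 0#
  sumF {suc n} f = f zero + sumF (λ i → f (suc i))

  -- A polynomial of degree n is given by its coefficients a₀ … aₙ
  -- (a : Fin (suc n) → Carrier) with aₙ ≠ 0.
  Poly : ℕ → Set c
  Poly n = Fin (suc n) → Carrier

  HasDegree : (n : ℕ) → Poly n → Set ℓ
  HasDegree n a = ¬ (a (fromℕ n) ≈ 0#)

  eval : ∀ {n} → Poly n → Carrier → Carrier
  eval {n} a x = sumF (λ i → a i * pow x (toℕ i))

  coeff : ∀ {n} → Poly n → ℕ → Carrier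
  coeff {n} a j with j ℕ.<? suc n
  ... | yes j<n = a (Data.Fin.fromℕ< j<n)
  ... | no  _   = 0#

  coeffShift : ∀ {n} → ℕ → Poly n → ℕ → Carrier
  coeffShift m a j with j ℕ.<? m
  ... | yes _ = 0#
  ... | no  _ = coeff a (j ∸ m)

  module WithQ (q : ℕ) where
    conj : Carrier → Carrier
    conj a = pow a q

    InMu : Carrier → Set ℓ
    InMu x = pow x (suc q) ≈ 1#

    -- f̃(X) = Xⁿ f̄(X⁻¹): coefficient of Xⁱ is ā_{n-i}
    tilde : ∀ {n} → Poly n → Poly n
    tilde a i = conj (a (opposite i))

    module WithD (d : ℕ) .{{_ : NonZero d}} (ε : Carrier) (k : ℕ) where
      m : ℕ
      m = suc q ℕ./ d

      InA : Carrier → Set ℓ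
      InA x = InMu x × (pow x m ≈ pow ε k)

      -- L̃(x)/L(x) = λ x^τ for all x ∈ A_k (L has no root on A_k, so this is
      -- L̃(x) = λ x^τ L(x))
      Ident : ∀ {t} → Poly t → ℕ → Carrier → Set (c ⊔ ℓ)
      Ident L τ lam = ∀ x → InA x → eval (tilde L) x ≈ (lam * pow x τ) * eval L x

      Conclusion : (t : ℕ) → Poly t → Set (c ⊔ ℓ)
      Conclusion t L =
        (∀ τ lam → τ < m → InMu lam → Ident L τ lam →
           τ ≡ 0 ⊎ (m ∸ t ≤ τ × τ ≤ t))
        × (∀ lam → InMu lam →
             Ident L 0 lam ⇔ (∀ i → tilde L i ≈ lam * L i))
        × (∀ τ lam → InMu lam → m ∸ t ≤ τ → τ ≤ t →
             Ident L τ lam ⇔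
             (Σ (Poly (t ∸ τ)) λ P → Σ (Poly (τ ℕ.+ t ∸ m)) λ Q →
                HasDegree (t ∸ τ) P × (∀ i → tilde P i ≈ lam * P i)
              × HasDegree (τ ℕ.+ t ∸ m) Q
              × (∀ i → tilde Q i ≈ (lam * pow ε k) * Q i)
              × (∀ j → coeff L j ≈ coeff P j + coeffShift (m ∸ τ) Q j)))

module Submission where

-- For x ∈ A_k we have x^m = εᵏ, so reducing modulo X^m − εᵏ turns both L̃(x) and λ x^τ L(x) into
-- polynomials with m coefficients; the coefficient of X^j is conj(ℓ_{t−j}) on the left and
-- λ(ℓ_{j−τ} + εᵏ ℓ_{m+j−τ}) on the right. A_k has at least m elements: of the q² = 1 + Dm field
-- elements (D = d(q − 1)), those with x^m ≠ εᵏ are roots of a nonzero polynomial of degree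
-- (D − 1)m + 1. So the identity on A_k is equivalent to equality of these coefficients. At j = 0
-- and j = t this forces (i), as ℓ_t and ℓ_0 are nonzero; for τ = 0 it says L̃ = λL, which is (ii);
-- otherwise the coefficients j ≥ τ say that P = ℓ_0 + … + ℓ_{t−τ}X^{t−τ} satisfies P̃ = λP and
-- that ℓ_i = 0 strictly between t − τ and m − τ, while those with j < τ say that
-- Q = ℓ_{m−τ} + … + ℓ_t X^{τ+t−m} satisfies Q̃ = λεᵏQ, which is (iii).

open import Defs
open import Level using (Level; _⊔_)
open import Algebra.Bundles using (CommutativeRing)
open import Data.Nat as ℕ using (ℕ; zero; suc; _<_; _≤_; z≤n; s≤s; _∸_; _^_; NonZero)
import Data.Nat.Properties as ℕ
open import Data.Nat.Divisibility using (_∣_)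
open import Data.Nat.DivMod using (m/n*n≡m)
open import Data.Nat.Primality using (prime)
open import Data.Nat.Solver using (module +-*-Solver)
open import Data.Fin using (Fin; zero; suc; toℕ; fromℕ; fromℕ<; opposite; punchIn; punchOut; _≟_)
import Data.Fin.Properties as Fin
open import Data.Fin.Permutation using (Permutation; permutation)
open import Data.Product using (Σ; _×_; _,_; proj₁; proj₂)
open import Data.Sum using (_⊎_; inj₁; inj₂)
open import Function using (_∘_)
open import Function.Bundles using (_⇔_; mk⇔; module Equivalence)
open import Function.Definitions using (Injective)
import Function.Properties.Equivalence as ⇔
open import Relation.Nullary using (¬_; Dec; yes; no; contradiction)
open import Relation.Unary using (Pred; Decidable)
open import Relation.Binary.PropositionalEquality as ≡ using (_≡_; _≢_)

module Polynomials {c ℓ} (R : CommutativeRing c ℓ) where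
  open FF R
  open CommutativeRing R hiding (Carrier; _≈_; _+_; _*_; 0#; 1#; zero)
  open import Algebra.Properties.Semiring.Exp semiring
    using (^-congˡ; ^-homo-*; ^-assocʳ) renaming (_^_ to _^ᴿ_)
  open import Relation.Binary.Reasoning.Setoid setoid
  open import Algebra.Solver.Ring.NaturalCoefficients.Default commutativeSemiring

  pow≡^ : ∀ x n → pow x n ≡ x ^ᴿ n
  pow≡^ x zero    = ≡.refl
  pow≡^ x (suc n) = ≡.cong (x *_) (pow≡^ x n)

  pow-congˡ : ∀ {x y} n → x ≈ y → pow x n ≈ pow y n
  pow-congˡ {x} {y} n x≈y rewrite pow≡^ x n | pow≡^ y n = ^-congˡ n x≈y

  pow-homo-* : ∀ x a b → pow x (a ℕ.+ b) ≈ pow x a * pow x b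
  pow-homo-* x a b rewrite pow≡^ x (a ℕ.+ b) | pow≡^ x a | pow≡^ x b = ^-homo-* x a b

  pow-assocʳ : ∀ x a b → pow (pow x a) b ≈ pow x (a ℕ.* b)
  pow-assocʳ x a b rewrite pow≡^ (pow x a) b | pow≡^ x a | pow≡^ x (a ℕ.* b) = ^-assocʳ x a b

  pow-1# : ∀ n → pow 1# n ≈ 1#
  pow-1# zero    = refl
  pow-1# (suc n) = trans (*-identityˡ _) (pow-1# n)

  ∑ : ℕ → (ℕ → Carrier) → Carrier
  ∑ zero    f = 0#
  ∑ (suc n) f = f 0 + ∑ n (f ∘ suc)

  ∑-cong : ∀ n {f g} → (∀ j → j < n → f j ≈ g j) → ∑ n f ≈ ∑ n g
  ∑-cong zero    f≈g = refl
  ∑-cong (suc n) f≈g = +-cong (f≈g 0 (s≤s z≤n)) (∑-cong n (λ j j<n → f≈g (suc j) (s≤s j<n)))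

  ∑-zero : ∀ n {f} → (∀ j → j < n → f j ≈ 0#) → ∑ n f ≈ 0#
  ∑-zero n {f} f≈0 = trans (∑-cong n f≈0) (∑-const0 n)
    where
    ∑-const0 : ∀ n → ∑ n (λ _ → 0#) ≈ 0#
    ∑-const0 zero    = refl
    ∑-const0 (suc n) = trans (+-identityˡ _) (∑-const0 n)

  ∑-distrib-+ : ∀ n f g → ∑ n (λ j → f j + g j) ≈ ∑ n f + ∑ n g
  ∑-distrib-+ zero    f g = sym (+-identityˡ _)
  ∑-distrib-+ (suc n) f g = trans (+-congˡ (∑-distrib-+ n _ _))
    (solve 4 (λ a b c d → (a :+ b) :+ (c :+ d) := (a :+ c) :+ (b :+ d)) refl _ _ _ _)

  *-distribˡ-∑ : ∀ n a f → a * ∑ n f ≈ ∑ n (λ j → a * f j)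
  *-distribˡ-∑ zero    a f = zeroʳ a
  *-distribˡ-∑ (suc n) a f = trans (distribˡ _ _ _) (+-congˡ (*-distribˡ-∑ n a _))

  ∑-split : ∀ a b f → ∑ (a ℕ.+ b) f ≈ ∑ a f + ∑ b (λ j → f (a ℕ.+ j))
  ∑-split zero    b f = sym (+-identityˡ _)
  ∑-split (suc a) b f = trans (+-congˡ (∑-split a b _)) (sym (+-assoc _ _ _))

  evalUpTo : ℕ → (ℕ → Carrier) → Carrier → Carrier
  evalUpTo n b x = ∑ n (λ j → b j * pow x j)

  evalUpTo-cong : ∀ n {b b'} x → (∀ j → j < n → b j ≈ b' j) → evalUpTo n b x ≈ evalUpTo n b' x
  evalUpTo-cong n x b≈b' = ∑-cong n (λ j j<n → *-congʳ (b≈b' j j<n))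

  evalUpTo-zero : ∀ n {b} x → (∀ j → j < n → b j ≈ 0#) → evalUpTo n b x ≈ 0#
  evalUpTo-zero n x b≈0 = ∑-zero n (λ j j<n → trans (*-congʳ (b≈0 j j<n)) (zeroˡ _))

  evalUpTo-suc : ∀ n b x → evalUpTo (suc n) b x ≈ b 0 + x * evalUpTo n (b ∘ suc) x
  evalUpTo-suc n b x = +-cong (*-identityʳ _) (begin
    ∑ n (λ j → b (suc j) * (x * pow x j))   ≈⟨ ∑-cong n (λ j _ → x*[y*z]≈y*[x*z] (b (suc j)) x (pow x j)) ⟩
    ∑ n (λ j → x * (b (suc j) * pow x j))   ≈⟨ *-distribˡ-∑ n x _ ⟨
    x * evalUpTo n (b ∘ suc) x              ∎)
    where
    x*[y*z]≈y*[x*z] : ∀ a y z → a * (y * z) ≈ y * (a * z)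
    x*[y*z]≈y*[x*z] = solve 3 (λ a y z → a :* (y :* z) := y :* (a :* z)) refl

  evalUpTo-split : ∀ a n b x →
    evalUpTo (a ℕ.+ n) b x ≈ evalUpTo a b x + pow x a * evalUpTo n (λ j → b (a ℕ.+ j)) x
  evalUpTo-split a n b x = trans (∑-split a n _) (+-congˡ (begin
    ∑ n (λ j → b (a ℕ.+ j) * pow x (a ℕ.+ j))         ≈⟨ ∑-cong n (λ j _ → reorder j) ⟩
    ∑ n (λ j → pow x a * (b (a ℕ.+ j) * pow x j))     ≈⟨ *-distribˡ-∑ n _ _ ⟨
    pow x a * evalUpTo n (λ j → b (a ℕ.+ j)) x        ∎))
    where
    reorder : ∀ j → b (a ℕ.+ j) * pow x (a ℕ.+ j) ≈ pow x a * (b (a ℕ.+ j) * pow x j)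
    reorder j = trans (*-congˡ (pow-homo-* x a j))
      (solve 3 (λ u v w → u :* (v :* w) := v :* (u :* w)) refl _ _ _)

  evalUpTo-extend : ∀ {n N} b x → n ≤ N → (∀ j → n ≤ j → b j ≈ 0#) →
                    evalUpTo N b x ≈ evalUpTo n b x
  evalUpTo-extend {n} {N} b x n≤N b≈0 = begin
    evalUpTo N b x                                         ≡⟨ ≡.cong (λ k → evalUpTo k b x) (ℕ.m+[n∸m]≡n n≤N) ⟨
    evalUpTo (n ℕ.+ (N ∸ n)) b x                           ≈⟨ evalUpTo-split n (N ∸ n) b x ⟩
    evalUpTo n b x + pow x n * evalUpTo (N ∸ n) _ x        ≈⟨ +-congˡ (*-congˡ (evalUpTo-zero (N ∸ n) x (λ j _ → b≈0 _ (ℕ.m≤m+n n j)))) ⟩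
    evalUpTo n b x + pow x n * 0#                          ≈⟨ +-congˡ (zeroʳ _) ⟩
    evalUpTo n b x + 0#                                    ≈⟨ +-identityʳ _ ⟩
    evalUpTo n b x                                         ∎

  evalUpTo-linear : ∀ n f g a x →
    evalUpTo n f x + a * evalUpTo n g x ≈ evalUpTo n (λ j → f j + a * g j) x
  evalUpTo-linear n f g a x = begin
    evalUpTo n f x + a * evalUpTo n g x                    ≈⟨ +-congˡ (*-distribˡ-∑ n a _) ⟩
    ∑ n (λ j → f j * pow x j) + ∑ n (λ j → a * (g j * pow x j)) ≈⟨ ∑-distrib-+ n _ _ ⟨
    ∑ n (λ j → f j * pow x j + a * (g j * pow x j))        ≈⟨ ∑-cong n (λ j _ → collect (f j) a (g j) (pow x j)) ⟩
    evalUpTo n (λ j → f j + a * g j) x                     ∎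
    where
    collect : ∀ u a v p → u * p + a * (v * p) ≈ (u + a * v) * p
    collect = solve 4 (λ u a v p → u :* p :+ a :* (v :* p) := (u :+ a :* v) :* p) refl

  *-distribˡ-evalUpTo : ∀ n f a x → a * evalUpTo n f x ≈ evalUpTo n (λ j → a * f j) x
  *-distribˡ-evalUpTo n f a x = trans (*-distribˡ-∑ n a _) (∑-cong n (λ j _ → sym (*-assoc _ _ _)))

  shift : ℕ → (ℕ → Carrier) → ℕ → Carrier
  shift zero    b i       = b i
  shift (suc k) b zero    = 0#
  shift (suc k) b (suc i) = shift k b i

  shift-+ : ∀ k b j → shift k b (k ℕ.+ j) ≡ b j
  shift-+ zero    b j = ≡.refl
  shift-+ (suc k) b j = shift-+ k b j

  shift-< : ∀ k b i → i < k → shift k b i ≡ 0#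
  shift-< (suc k) b zero    _         = ≡.refl
  shift-< (suc k) b (suc i) (s≤s i<k) = shift-< k b i i<k

  shift-≥ : ∀ k b i → k ≤ i → shift k b i ≡ b (i ∸ k)
  shift-≥ zero    b i       _         = ≡.refl
  shift-≥ (suc k) b (suc i) (s≤s k≤i) = shift-≥ k b i k≤i

  shift-0# : ∀ k i → shift k (λ _ → 0#) i ≡ 0#
  shift-0# zero    i       = ≡.refl
  shift-0# (suc k) zero    = ≡.refl
  shift-0# (suc k) (suc i) = shift-0# k i

  evalUpTo-shift : ∀ k n b x → pow x k * evalUpTo n b x ≈ evalUpTo (k ℕ.+ n) (shift k b) x
  evalUpTo-shift k n b x = sym (begin
    evalUpTo (k ℕ.+ n) (shift k b) x
      ≈⟨ evalUpTo-split k n (shift k b) x ⟩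
    evalUpTo k (shift k b) x + pow x k * evalUpTo n (λ j → shift k b (k ℕ.+ j)) x
      ≈⟨ +-cong (evalUpTo-zero k x (λ j j<k → reflexive (shift-< k b j j<k)))
                (*-congˡ (evalUpTo-cong n x (λ j _ → reflexive (shift-+ k b j)))) ⟩
    0# + pow x k * evalUpTo n b x
      ≈⟨ +-identityˡ _ ⟩
    pow x k * evalUpTo n b x ∎)

  -- Coefficients of (b(X) − b(r)) / (X − r) for b with suc n coefficients.
  quotient : ℕ → Carrier → (ℕ → Carrier) → ℕ → Carrier
  quotient zero    r b j       = 0#
  quotient (suc n) r b zero    = evalUpTo (suc n) (b ∘ suc) r
  quotient (suc n) r b (suc j) = quotient n r (b ∘ suc) j

  -- b(x) − b(r) = (x − r) · quotient(x), with both sides moved so that no subtraction occurs.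
  evalUpTo-quotient : ∀ n b r x →
    evalUpTo (suc n) b x + r * evalUpTo n (quotient n r b) x ≈
    evalUpTo (suc n) b r + x * evalUpTo n (quotient n r b) x
  evalUpTo-quotient zero    b r x = +-congˡ (trans (zeroʳ r) (sym (zeroʳ x)))
  evalUpTo-quotient (suc n) b r x = begin
    evalUpTo (suc (suc n)) b x + r * evalUpTo (suc n) (quotient (suc n) r b) x
      ≈⟨ +-cong (evalUpTo-suc (suc n) b x) (*-congˡ (evalUpTo-suc n (quotient (suc n) r b) x)) ⟩
    (b 0 + x * B′x) + r * (B′r + x * Qx)
      ≈⟨ regroup (b 0) x r B′r B′x Qx ⟩
    (b 0 + r * B′r) + x * (B′x + r * Qx)
      ≈⟨ +-congˡ (*-congˡ (evalUpTo-quotient n (b ∘ suc) r x)) ⟩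
    (b 0 + r * B′r) + x * (B′r + x * Qx)
      ≈⟨ +-cong (evalUpTo-suc (suc n) b r) (*-congˡ (evalUpTo-suc n (quotient (suc n) r b) x)) ⟨
    evalUpTo (suc (suc n)) b r + x * evalUpTo (suc n) (quotient (suc n) r b) x ∎
    where
    B′x = evalUpTo (suc n) (b ∘ suc) x
    B′r = evalUpTo (suc n) (b ∘ suc) r
    Qx  = evalUpTo n (quotient n r (b ∘ suc)) x
    regroup : ∀ b₀ x r u v w → (b₀ + x * v) + r * (u + x * w) ≈ (b₀ + r * u) + x * (v + r * w)
    regroup = solve 6 (λ b₀ x r u v w →
      (b₀ :+ x :* v) :+ r :* (u :+ x :* w) := (b₀ :+ r :* u) :+ x :* (v :+ r :* w)) refl

  quotient≈0∧root⇒coeffs≈0 : ∀ n b r → (∀ j → j < n → quotient n r b j ≈ 0#) →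
    evalUpTo (suc n) b r ≈ 0# → ∀ j → j < suc n → b j ≈ 0#
  quotient≈0∧root⇒coeffs≈0 zero b r _ root zero _ = begin
    b 0              ≈⟨ *-identityʳ _ ⟨
    b 0 * 1#         ≈⟨ +-identityʳ _ ⟨
    evalUpTo 1 b r   ≈⟨ root ⟩
    0#               ∎
  quotient≈0∧root⇒coeffs≈0 zero b r _ _ (suc j) (s≤s ())
  quotient≈0∧root⇒coeffs≈0 (suc n) b r q≈0 root zero _ = begin
    b 0                                        ≈⟨ +-identityʳ _ ⟨
    b 0 + 0#                                   ≈⟨ +-congˡ (trans (*-congˡ (q≈0 0 (s≤s z≤n))) (zeroʳ r)) ⟨
    b 0 + r * evalUpTo (suc n) (b ∘ suc) r     ≈⟨ evalUpTo-suc (suc n) b r ⟨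
    evalUpTo (suc (suc n)) b r                 ≈⟨ root ⟩
    0#                                         ∎
  quotient≈0∧root⇒coeffs≈0 (suc n) b r q≈0 _ (suc j) (s≤s j<) =
    quotient≈0∧root⇒coeffs≈0 n (b ∘ suc) r (λ i i< → q≈0 (suc i) (s≤s i<)) (q≈0 0 (s≤s z≤n)) j j<

  -- Coefficients of (Y^D − c^D) / (Y − c) = Σ_{j<D} c^(D−1−j) Y^j.
  geometric : Carrier → ℕ → ℕ → Carrier
  geometric c D j = pow c (D ∸ suc j)

  evalUpTo-geometric : ∀ c D y →
    y * evalUpTo D (geometric c D) y + pow c D ≈ c * evalUpTo D (geometric c D) y + pow y D
  evalUpTo-geometric c zero    y = +-congʳ (trans (zeroʳ y) (sym (zeroʳ c)))
  evalUpTo-geometric c (suc D) y = begin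
    y * evalUpTo (suc D) (geometric c (suc D)) y + c * C
      ≈⟨ +-congʳ (*-congˡ (evalUpTo-suc D (geometric c (suc D)) y)) ⟩
    y * (C + y * G) + c * C
      ≈⟨ solve 4 (λ y C G c → y :* (C :+ y :* G) :+ c :* C := c :* C :+ y :* (y :* G :+ C)) refl y C G c ⟩
    c * C + y * (y * G + C)
      ≈⟨ +-congˡ (*-congˡ (evalUpTo-geometric c D y)) ⟩
    c * C + y * (c * G + pow y D)
      ≈⟨ solve 5 (λ y C G c Y → c :* C :+ y :* (c :* G :+ Y) := c :* (C :+ y :* G) :+ y :* Y) refl y C G c (pow y D) ⟩
    c * (C + y * G) + y * pow y D
      ≈⟨ +-congʳ (*-congˡ (evalUpTo-suc D (geometric c (suc D)) y)) ⟨
    c * evalUpTo (suc D) (geometric c (suc D)) y + pow y (suc D) ∎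
    where
    C = pow c D
    G = evalUpTo D (geometric c D) y

  -- Coefficients of b(X^(suc m′)) for b with D coefficients.
  atPow : ℕ → ℕ → (ℕ → Carrier) → ℕ → Carrier
  atPow m′ zero    b i       = 0#
  atPow m′ (suc D) b zero    = b 0
  atPow m′ (suc D) b (suc i) = shift m′ (atPow m′ D (b ∘ suc)) i

  evalUpTo-atPow : ∀ m′ D b x →
    evalUpTo (D ℕ.* suc m′) (atPow m′ D b) x ≈ evalUpTo D b (pow x (suc m′))
  evalUpTo-atPow m′ zero    b x = refl
  evalUpTo-atPow m′ (suc D) b x = begin
    evalUpTo (suc m′ ℕ.+ D ℕ.* suc m′) (atPow m′ (suc D) b) x
      ≈⟨ evalUpTo-split (suc m′) (D ℕ.* suc m′) (atPow m′ (suc D) b) x ⟩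
    evalUpTo (suc m′) (atPow m′ (suc D) b) x + xᵐ * evalUpTo (D ℕ.* suc m′) (λ j → atPow m′ (suc D) b (suc m′ ℕ.+ j)) x
      ≈⟨ +-cong lowPart (*-congˡ (evalUpTo-cong (D ℕ.* suc m′) x (λ j _ → reflexive (shift-+ m′ _ j)))) ⟩
    b 0 + xᵐ * evalUpTo (D ℕ.* suc m′) (atPow m′ D (b ∘ suc)) x
      ≈⟨ +-congˡ (*-congˡ (evalUpTo-atPow m′ D (b ∘ suc) x)) ⟩
    b 0 + xᵐ * evalUpTo D (b ∘ suc) xᵐ
      ≈⟨ evalUpTo-suc D b xᵐ ⟨
    evalUpTo (suc D) b xᵐ ∎
    where
    xᵐ = pow x (suc m′)
    lowPart : evalUpTo (suc m′) (atPow m′ (suc D) b) x ≈ b 0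
    lowPart = begin
      evalUpTo (suc m′) (atPow m′ (suc D) b) x
        ≈⟨ evalUpTo-suc m′ (atPow m′ (suc D) b) x ⟩
      b 0 + x * evalUpTo m′ (shift m′ (atPow m′ D (b ∘ suc))) x
        ≈⟨ +-congˡ (*-congˡ (evalUpTo-zero m′ x (λ j j< → reflexive (shift-< m′ (atPow m′ D (b ∘ suc)) j j<)))) ⟩
      b 0 + x * 0#
        ≈⟨ trans (+-congˡ (zeroʳ x)) (+-identityʳ _) ⟩
      b 0 ∎

  atPow-last : ∀ m′ D b → atPow m′ (suc D) b (D ℕ.* suc m′) ≡ b D
  atPow-last m′ zero    b = ≡.refl
  atPow-last m′ (suc D) b = ≡.trans (shift-+ m′ _ (D ℕ.* suc m′)) (atPow-last m′ D (b ∘ suc))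

  atPow-beyond : ∀ m′ D b i → D ℕ.* suc m′ < i → atPow m′ (suc D) b i ≡ 0#
  atPow-beyond m′ zero    b (suc i) _        = shift-0# m′ i
  atPow-beyond m′ (suc D) b (suc i) (s≤s lt) = ≡.trans (shift-≥ m′ _ i m′≤i)
      (atPow-beyond m′ D (b ∘ suc) (i ∸ m′) (ℕ.+-cancelˡ-< m′ _ _ (ℕ.<-≤-trans lt (ℕ.≤-reflexive (≡.sym (ℕ.m+[n∸m]≡n m′≤i))))))
    where
    m′≤i : m′ ≤ i
    m′≤i = ℕ.≤-trans (ℕ.m≤m+n m′ _) (ℕ.<⇒≤ lt)

module Coefficients {c ℓ} (R : CommutativeRing c ℓ) where
  open FF R
  open CommutativeRing R hiding (Carrier; _≈_; _+_; _*_; 0#; 1#; zero)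
  open Polynomials R
  open import Relation.Binary.Reasoning.Setoid setoid

  coeff-< : ∀ {n} (a : Poly n) j (j<1+n : j < suc n) → coeff a j ≡ a (fromℕ< j<1+n)
  coeff-< {n} a j j<1+n with j ℕ.<? suc n
  ... | yes j<1+n′ = ≡.cong a (Fin.fromℕ<-cong j j ≡.refl j<1+n′ j<1+n)
  ... | no  j≮1+n  = contradiction j<1+n j≮1+n

  coeff-≥ : ∀ {n} (a : Poly n) j → suc n ≤ j → coeff a j ≡ 0#
  coeff-≥ {n} a j n<j with j ℕ.<? suc n
  ... | yes j<1+n = contradiction n<j (ℕ.<⇒≱ j<1+n)
  ... | no  _     = ≡.refl

  coeff-toℕ : ∀ {n} (a : Poly n) i → coeff a (toℕ i) ≡ a i
  coeff-toℕ a i = ≡.trans (coeff-< a (toℕ i) (Fin.toℕ<n i)) (≡.cong a (Fin.fromℕ<-toℕ i _))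

  HasDegree⇒coeff≉0 : ∀ {n} (a : Poly n) → HasDegree n a → ¬ (coeff a n ≈ 0#)
  HasDegree⇒coeff≉0 {n} a deg≉0 aₙ≈0 =
    deg≉0 (trans (reflexive (≡.trans (≡.sym (coeff-toℕ a (fromℕ n))) (≡.cong (coeff a) (Fin.toℕ-fromℕ n)))) aₙ≈0)

  coeffShift-< : ∀ {n} k (a : Poly n) j → j < k → coeffShift k a j ≡ 0#
  coeffShift-< k a j j<k with j ℕ.<? k
  ... | yes _   = ≡.refl
  ... | no  j≮k = contradiction j<k j≮k

  coeffShift-≥ : ∀ {n} k (a : Poly n) j → k ≤ j → coeffShift k a j ≡ coeff a (j ∸ k)
  coeffShift-≥ k a j k≤j with j ℕ.<? k
  ... | yes j<k = contradiction k≤j (ℕ.<⇒≱ j<k)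
  ... | no  _   = ≡.refl

  eval≈evalUpTo : ∀ {n} (a : Poly n) x {N} → suc n ≤ N → eval a x ≈ evalUpTo N (coeff a) x
  eval≈evalUpTo {n} a x {N} n<N = begin
    sumF {suc n} (λ i → a i * pow x (toℕ i))        ≈⟨ sumF-cong {suc n} (λ i → *-congʳ {pow x (toℕ i)} (reflexive (≡.sym (coeff-toℕ a i)))) ⟩
    sumF {suc n} (λ i → coeff a (toℕ i) * pow x (toℕ i)) ≡⟨ sumF-toℕ (suc n) (λ j → coeff a j * pow x j) ⟩
    evalUpTo (suc n) (coeff a) x                    ≈⟨ evalUpTo-extend (coeff a) x n<N (λ j n<j → reflexive (coeff-≥ a j n<j)) ⟨
    evalUpTo N (coeff a) x                          ∎
    where
    sumF-cong : ∀ {n} {f g : Fin n → Carrier} → (∀ i → f i ≈ g i) → sumF f ≈ sumF g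
    sumF-cong {zero}  f≈g = refl
    sumF-cong {suc n} f≈g = +-cong (f≈g zero) (sumF-cong (f≈g ∘ suc))
    sumF-toℕ : ∀ n (f : ℕ → Carrier) → sumF {n} (f ∘ toℕ) ≡ ∑ n f
    sumF-toℕ zero    f = ≡.refl
    sumF-toℕ (suc n) f = ≡.cong (f 0 +_) (sumF-toℕ n (f ∘ suc))

  module _ (q : ℕ) where
    open WithQ q

    coeff-tilde : ∀ {n} (a : Poly n) j → j ≤ n → coeff (tilde a) j ≡ conj (coeff a (n ∸ j))
    coeff-tilde {n} a j j≤n = ≡.trans (coeff-< (tilde a) j (s≤s j≤n)) (≡.cong conj (≡.trans
        (≡.sym (coeff-toℕ a (opposite i)))
        (≡.cong (coeff a) (≡.trans (Fin.opposite-prop i) (≡.cong (n ∸_) (Fin.toℕ-fromℕ< (s≤s j≤n)))))))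
      where i = fromℕ< (s≤s j≤n)

    tilde≡conj-coeff : ∀ {n} (a : Poly n) i → tilde a i ≡ conj (coeff a (n ∸ toℕ i))
    tilde≡conj-coeff a i = ≡.trans (≡.sym (coeff-toℕ (tilde a) i)) (coeff-tilde a (toℕ i) (ℕ.≤-pred (Fin.toℕ<n i)))

    Reciprocal : ℕ → Carrier → (ℕ → Carrier) → Set ℓ
    Reciprocal n μ f = ∀ j → j ≤ n → conj (f (n ∸ j)) ≈ μ * f j

    Reciprocal-cong : ∀ {n μ f g} → (∀ j → j ≤ n → f j ≈ g j) → Reciprocal n μ f → Reciprocal n μ g
    Reciprocal-cong {n} f≈g rec j j≤n =
      trans (pow-congˡ q (sym (f≈g (n ∸ j) (ℕ.m∸n≤m n j)))) (trans (rec j j≤n) (*-congˡ (f≈g j j≤n)))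

    tilde≈*⇔Reciprocal : ∀ {n} (a : Poly n) μ → (∀ i → tilde a i ≈ μ * a i) ⇔ Reciprocal n μ (coeff a)
    tilde≈*⇔Reciprocal {n} a μ = mk⇔
      (λ tilde≈ j j≤n → begin
        conj (coeff a (n ∸ j))          ≡⟨ coeff-tilde a j j≤n ⟨
        coeff (tilde a) j               ≡⟨ coeff-< (tilde a) j (s≤s j≤n) ⟩
        tilde a (fromℕ< (s≤s j≤n))      ≈⟨ tilde≈ _ ⟩
        μ * a (fromℕ< (s≤s j≤n))        ≡⟨ ≡.cong (μ *_) (coeff-< a j (s≤s j≤n)) ⟨
        μ * coeff a j                   ∎)
      (λ rec i → begin
        tilde a i                       ≡⟨ tilde≡conj-coeff a i ⟩
        conj (coeff a (n ∸ toℕ i))      ≈⟨ rec (toℕ i) (ℕ.≤-pred (Fin.toℕ<n i)) ⟩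
        μ * coeff a (toℕ i)             ≡⟨ ≡.cong (μ *_) (coeff-toℕ a i) ⟩
        μ * a i                         ∎)

  coeff-tabulate : ∀ n (f : ℕ → Carrier) j → j ≤ n → coeff {n} (f ∘ toℕ) j ≡ f j
  coeff-tabulate n f j j≤n = ≡.trans (coeff-< (f ∘ toℕ) j (s≤s j≤n)) (≡.cong f (Fin.toℕ-fromℕ< (s≤s j≤n)))

module Counting {p : Level} where

  count : ∀ {N} {P : Pred (Fin N) p} → Decidable P → ℕ
  count {zero}  P? = 0
  count {suc N} P? with P? zero
  ... | yes _ = suc (count (P? ∘ suc))
  ... | no  _ = count (P? ∘ suc)

  count-witnesses : ∀ {N} {P : Pred (Fin N) p} (P? : Decidable P) K → K ≤ count P? →
                    Σ (Fin K → Fin N) λ f → Injective _≡_ _≡_ f × (∀ i → P (f i))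
  count-witnesses P? zero _ = (λ ()) , (λ {}) , (λ ())
  count-witnesses {suc N} P? (suc K) K<c with P? zero
  ... | yes P0 = f , f-injective , P∘f
    where
    rest = count-witnesses (P? ∘ suc) K (ℕ.≤-pred K<c)
    f : Fin (suc K) → Fin (suc N)
    f zero    = zero
    f (suc i) = suc (proj₁ rest i)
    f-injective : Injective _≡_ _≡_ f
    f-injective {zero}  {zero}  _  = ≡.refl
    f-injective {suc i} {suc j} eq = ≡.cong suc (proj₁ (proj₂ rest) (Fin.suc-injective eq))
    P∘f : ∀ i → _
    P∘f zero    = P0
    P∘f (suc i) = proj₂ (proj₂ rest) i
  ... | no _ = suc ∘ proj₁ rest , proj₁ (proj₂ rest) ∘ Fin.suc-injective , proj₂ (proj₂ rest)
    where rest = count-witnesses (P? ∘ suc) (suc K) K<c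

  count-cover : ∀ {N} {P Q : Pred (Fin N) p} (P? : Decidable P) (Q? : Decidable Q) →
                (∀ i → P i ⊎ Q i) → N ≤ count P? ℕ.+ count Q?
  count-cover {zero} P? Q? _ = z≤n
  count-cover {suc N} P? Q? cover with P? zero | Q? zero | count-cover (P? ∘ suc) (Q? ∘ suc) (cover ∘ suc)
  ... | yes _ | yes _ | ih = s≤s (ℕ.≤-trans ih (ℕ.+-monoʳ-≤ _ (ℕ.n≤1+n _)))
  ... | yes _ | no _  | ih = s≤s ih
  ... | no _  | yes _ | ih = ℕ.≤-trans (s≤s ih) (ℕ.≤-reflexive (≡.sym (ℕ.+-suc _ _)))
  ... | no ¬P | no ¬Q | _ with cover zero
  ...   | inj₁ P0 = contradiction P0 ¬P
  ...   | inj₂ Q0 = contradiction Q0 ¬Q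

open Counting

module Fields {c ℓ} (R : CommutativeRing c ℓ) (isField : FF.IsField R) where
  open FF R
  open CommutativeRing R hiding (Carrier; _≈_; _+_; _*_; 0#; 1#; zero)
  open Polynomials R
  open import Algebra.Properties.Group +-group using (x∙y⁻¹≈ε⇒x≈y; x≈y⇒x∙y⁻¹≈ε)
  open import Algebra.Properties.Ring ring using ([y-z]x≈yx-zx; +-cancelʳ)
  open import Relation.Binary.Reasoning.Setoid setoid
  open import Algebra.Solver.Ring.NaturalCoefficients.Default commutativeSemiring
  open import Algebra.Properties.CommutativeMonoid.Sum *-commutativeMonoid
    using (sum-permute; sum-cong-≋) renaming (sum to ∏)

  1≉0 : ¬ (1# ≈ 0#)
  1≉0 = proj₁ isField

  x*y≈0⇒y≈0 : ∀ {x y} → ¬ (x ≈ 0#) → x * y ≈ 0# → y ≈ 0#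
  x*y≈0⇒y≈0 {x} {y} x≉0 xy≈0 = begin
    y                ≈⟨ *-identityˡ y ⟨
    1# * y           ≈⟨ *-congʳ x⁻¹x≈1 ⟨
    (x⁻¹ * x) * y    ≈⟨ *-assoc x⁻¹ x y ⟩
    x⁻¹ * (x * y)    ≈⟨ *-congˡ xy≈0 ⟩
    x⁻¹ * 0#         ≈⟨ zeroʳ x⁻¹ ⟩
    0#               ∎
    where
    x⁻¹ = proj₁ (proj₂ isField x x≉0)
    x⁻¹x≈1 : x⁻¹ * x ≈ 1#
    x⁻¹x≈1 = trans (*-comm x⁻¹ x) (proj₂ (proj₂ isField x x≉0))

  *-≉0 : ∀ {x y} → ¬ (x ≈ 0#) → ¬ (y ≈ 0#) → ¬ (x * y ≈ 0#)
  *-≉0 x≉0 y≉0 xy≈0 = y≉0 (x*y≈0⇒y≈0 x≉0 xy≈0)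

  pow-≉0 : ∀ {x} n → ¬ (x ≈ 0#) → ¬ (pow x n ≈ 0#)
  pow-≉0 zero    x≉0 = 1≉0
  pow-≉0 (suc n) x≉0 = *-≉0 x≉0 (pow-≉0 n x≉0)

  x*z≈y*z⇒z≈0 : ∀ {x y z} → ¬ (x ≈ y) → x * z ≈ y * z → z ≈ 0#
  x*z≈y*z⇒z≈0 {x} {y} {z} x≉y xz≈yz = x*y≈0⇒y≈0 (x≉y ∘ x∙y⁻¹≈ε⇒x≈y x y)
    (trans ([y-z]x≈yx-zx z x y) (x≈y⇒x∙y⁻¹≈ε xz≈yz))

  *-cancelʳ : ∀ {x y z} → ¬ (z ≈ 0#) → x * z ≈ y * z → x ≈ y
  *-cancelʳ {x} {y} {z} z≉0 xz≈yz = x∙y⁻¹≈ε⇒x≈y x y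
    (x*y≈0⇒y≈0 z≉0 (trans (*-comm z _) (trans ([y-z]x≈yx-zx z x y) (x≈y⇒x∙y⁻¹≈ε xz≈yz))))

  roots⇒coeffs≈0 : ∀ n b (p : Fin n → Carrier) → Injective _≡_ _≈_ p →
                   (∀ i → evalUpTo n b (p i) ≈ 0#) → ∀ j → j < n → b j ≈ 0#
  roots⇒coeffs≈0 zero    b p _ _ j ()
  roots⇒coeffs≈0 (suc n) b p p-injective roots =
    quotient≈0∧root⇒coeffs≈0 n b r
      (roots⇒coeffs≈0 n (quotient n r b) (p ∘ suc) (Fin.suc-injective ∘ p-injective) quotient-roots)
      (roots zero)
    where
    r = p zero
    quotient-roots : ∀ i → evalUpTo n (quotient n r b) (p (suc i)) ≈ 0#
    quotient-roots i = x*z≈y*z⇒z≈0 (λ x≈r → Fin.0≢1+n (≡.sym (p-injective x≈r))) (begin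
      p (suc i) * Qx                           ≈⟨ +-identityˡ _ ⟨
      0# + p (suc i) * Qx                      ≈⟨ +-congʳ (roots zero) ⟨
      evalUpTo (suc n) b r + p (suc i) * Qx    ≈⟨ evalUpTo-quotient n b r (p (suc i)) ⟨
      evalUpTo (suc n) b (p (suc i)) + r * Qx  ≈⟨ +-congʳ (roots (suc i)) ⟩
      0# + r * Qx                              ≈⟨ +-identityˡ _ ⟩
      r * Qx                                   ∎)
      where Qx = evalUpTo n (quotient n r b) (p (suc i))

  ∏-≉0 : ∀ k (f : Fin k → Carrier) → (∀ i → ¬ (f i ≈ 0#)) → ¬ (∏ f ≈ 0#)
  ∏-≉0 zero    f f≉0 = 1≉0
  ∏-≉0 (suc k) f f≉0 = *-≉0 (f≉0 zero) (∏-≉0 k (f ∘ suc) (f≉0 ∘ suc))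

  ∏-scale : ∀ k a (f : Fin k → Carrier) → ∏ (λ i → a * f i) ≈ pow a k * ∏ f
  ∏-scale zero    a f = sym (*-identityʳ _)
  ∏-scale (suc k) a f = trans (*-congˡ (∏-scale k a (f ∘ suc)))
    (solve 4 (λ a x p q → a :* x :* (p :* q) := a :* p :* (x :* q)) refl a (f zero) _ _)

  module FiniteField {n} (card : HasCard (suc n)) where

    enum : Fin (suc n) → Carrier
    enum = proj₁ card

    enum-injective : ∀ i j → enum i ≈ enum j → i ≡ j
    enum-injective = proj₁ (proj₂ card)

    index : Carrier → Fin (suc n)
    index x = proj₁ (proj₂ (proj₂ card) x)

    enum-index : ∀ x → enum (index x) ≈ x
    enum-index x = proj₂ (proj₂ (proj₂ card) x)

    _≈?_ : ∀ x y → Dec (x ≈ y)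
    x ≈? y with index x ≟ index y
    ... | yes ix≡iy = yes (trans (sym (enum-index x)) (trans (reflexive (≡.cong enum ix≡iy)) (enum-index y)))
    ... | no  ix≢iy = no (λ x≈y → ix≢iy (enum-injective _ _ (trans (enum-index x) (trans x≈y (sym (enum-index y))))))

    nonzero : Fin n → Carrier
    nonzero i = enum (punchIn (index 0#) i)

    nonzero-≉0 : ∀ i → ¬ (nonzero i ≈ 0#)
    nonzero-≉0 i ≈0 = Fin.punchInᵢ≢i (index 0#) i (enum-injective _ _ (trans ≈0 (sym (enum-index 0#))))

    nonzero-injective : Injective _≡_ _≈_ nonzero
    nonzero-injective {i} {j} eq = Fin.punchIn-injective (index 0#) i j (enum-injective _ _ eq)

    scale : ∀ a → ¬ (a ≈ 0#) → Fin n → Fin n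
    scale a a≉0 i = punchOut {i = index 0#} {j = index (a * nonzero i)} index≢0
      where
      index≢0 : index 0# ≢ index (a * nonzero i)
      index≢0 eq = *-≉0 a≉0 (nonzero-≉0 i)
        (trans (sym (enum-index _)) (trans (reflexive (≡.cong enum (≡.sym eq))) (enum-index 0#)))

    nonzero-scale : ∀ a a≉0 i → nonzero (scale a a≉0 i) ≈ a * nonzero i
    nonzero-scale a a≉0 i = trans (reflexive (≡.cong enum (Fin.punchIn-punchOut _))) (enum-index _)

    scale-inverse : ∀ a b a≉0 b≉0 → b * a ≈ 1# → ∀ i → scale b b≉0 (scale a a≉0 i) ≡ i
    scale-inverse a b a≉0 b≉0 ba≈1 i = nonzero-injective (begin
      nonzero (scale b b≉0 (scale a a≉0 i))   ≈⟨ nonzero-scale b b≉0 _ ⟩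
      b * nonzero (scale a a≉0 i)             ≈⟨ *-congˡ (nonzero-scale a a≉0 i) ⟩
      b * (a * nonzero i)                     ≈⟨ *-assoc b a _ ⟨
      (b * a) * nonzero i                     ≈⟨ *-congʳ ba≈1 ⟩
      1# * nonzero i                          ≈⟨ *-identityˡ _ ⟩
      nonzero i                               ∎)

    -- Multiplication by a permutes the nonzero elements, so it leaves their product unchanged.
    fermat : ∀ a → ¬ (a ≈ 0#) → pow a n ≈ 1#
    fermat a a≉0 = sym (*-cancelʳ (∏-≉0 n nonzero nonzero-≉0) (begin
      1# * ∏ nonzero                          ≈⟨ *-identityˡ _ ⟩
      ∏ nonzero                               ≈⟨ sum-permute nonzero π ⟩
      ∏ (nonzero ∘ scale a a≉0)               ≈⟨ sum-cong-≋ (nonzero-scale a a≉0) ⟩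
      ∏ (λ i → a * nonzero i)                 ≈⟨ ∏-scale n a nonzero ⟩
      pow a n * ∏ nonzero                     ∎))
      where
      a⁻¹ = proj₁ (proj₂ isField a a≉0)
      aa⁻¹≈1 : a * a⁻¹ ≈ 1#
      aa⁻¹≈1 = proj₂ (proj₂ isField a a≉0)
      a⁻¹≉0 : ¬ (a⁻¹ ≈ 0#)
      a⁻¹≉0 a⁻¹≈0 = 1≉0 (trans (sym aa⁻¹≈1) (trans (*-congˡ a⁻¹≈0) (zeroʳ a)))
      π : Permutation n n
      π = permutation (scale a a≉0) (scale a⁻¹ a⁻¹≉0)
            (scale-inverse a⁻¹ a a⁻¹≉0 a≉0 aa⁻¹≈1)
            (scale-inverse a a⁻¹ a≉0 a⁻¹≉0 (trans (*-comm a⁻¹ a) aa⁻¹≈1))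

  -- Every nonzero x has (x^m)^D = 1, so either x^m = c or x^m is a root of (Y^D − c^D)/(Y − c).
  -- The latter, together with 0, are roots of X·G(X) where G(X) = ((Y^D − c^D)/(Y − c))(X^m) has
  -- degree (D − 1)m; so there are at most (D − 1)m + 1 of them, leaving at least m solutions of
  -- x^m = c among the 1 + Dm field elements.
  module PowerEquation {D′ m′ : ℕ} {c : Carrier} (c^D≈1 : pow c (suc D′) ≈ 1#)
                       (card : HasCard (suc (suc D′ ℕ.* suc m′))) where
    open FiniteField card

    D m deg : ℕ
    D   = suc D′
    m   = suc m′
    deg = suc (D′ ℕ.* m)

    G : ℕ → Carrier
    G = atPow m′ D (geometric c D)

    XG : ℕ → Carrier
    XG = shift 1 G

    IsSolution IsRoot : Pred (Fin (suc (D ℕ.* m))) ℓ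
    IsSolution i = pow (enum i) m ≈ c
    IsRoot     i = evalUpTo (suc deg) XG (enum i) ≈ 0#

    IsSolution? : Decidable IsSolution
    IsSolution? i = pow (enum i) m ≈? c

    IsRoot? : Decidable IsRoot
    IsRoot? i = evalUpTo (suc deg) XG (enum i) ≈? 0#

    evalUpTo-XG : ∀ x → evalUpTo (suc deg) XG x ≈ x * evalUpTo (D ℕ.* m) G x
    evalUpTo-XG x = begin
      evalUpTo (suc deg) XG x         ≈⟨ evalUpTo-shift 1 deg G x ⟨
      (x * 1#) * evalUpTo deg G x     ≈⟨ *-cong (*-identityʳ x) (sym (evalUpTo-extend G x deg≤Dm G-beyond)) ⟩
      x * evalUpTo (D ℕ.* m) G x      ∎
      where
      deg≤Dm : deg ≤ D ℕ.* m
      deg≤Dm = s≤s (ℕ.m≤n+m (D′ ℕ.* m) m′)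
      G-beyond : ∀ j → deg ≤ j → G j ≈ 0#
      G-beyond j = reflexive ∘ atPow-beyond m′ D′ (geometric c D) j

    solution-or-root : ∀ i → IsSolution i ⊎ IsRoot i
    solution-or-root i with enum i ≈? 0# | pow (enum i) m ≈? c
    ... | yes x≈0 | _        = inj₂ (trans (evalUpTo-XG (enum i)) (trans (*-congʳ x≈0) (zeroˡ _)))
    ... | no _    | yes xᵐ≈c = inj₁ xᵐ≈c
    ... | no x≉0  | no xᵐ≉c  = inj₂ (trans (evalUpTo-XG x) (trans (*-congˡ G[x]≈0) (zeroʳ x)))
      where
      x = enum i
      y = pow x m
      H = evalUpTo D (geometric c D) y
      yᴰ≈1 : pow y D ≈ 1#
      yᴰ≈1 = trans (pow-assocʳ x m D) (trans (reflexive (≡.cong (pow x) (ℕ.*-comm m D))) (fermat x x≉0))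
      yH≈cH : y * H ≈ c * H
      yH≈cH = +-cancelʳ 1# _ _ (begin
        y * H + 1#          ≈⟨ +-congˡ c^D≈1 ⟨
        y * H + pow c D     ≈⟨ evalUpTo-geometric c D y ⟩
        c * H + pow y D     ≈⟨ +-congˡ yᴰ≈1 ⟩
        c * H + 1#          ∎)
      G[x]≈0 : evalUpTo (D ℕ.* m) G x ≈ 0#
      G[x]≈0 = trans (evalUpTo-atPow m′ D (geometric c D) x) (x*z≈y*z⇒z≈0 xᵐ≉c yH≈cH)

    #roots≤deg : count IsRoot? ≤ deg
    #roots≤deg with count IsRoot? ℕ.≤? deg
    ... | yes ≤deg = ≤deg
    ... | no  ≰deg =
      let (f , f-injective , roots) = count-witnesses IsRoot? (suc deg) (ℕ.≰⇒> ≰deg)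
      in contradiction
           (roots⇒coeffs≈0 (suc deg) XG (enum ∘ f) (λ eq → f-injective (enum-injective _ _ eq)) roots deg ℕ.≤-refl)
           XG[deg]≉0
      where
      XG[deg]≉0 : ¬ (XG deg ≈ 0#)
      XG[deg]≉0 XG[deg]≈0 = 1≉0 (trans (reflexive (≡.sym (≡.trans (atPow-last m′ D′ (geometric c D))
        (≡.cong (pow c) (ℕ.n∸n≡0 D′))))) XG[deg]≈0)

    m≤#solutions : m ≤ count IsSolution?
    m≤#solutions = ℕ.+-cancelʳ-≤ deg m (count IsSolution?)
      (ℕ.≤-trans (ℕ.≤-reflexive (ℕ.+-suc m (D′ ℕ.* m)))
        (ℕ.≤-trans (count-cover IsSolution? IsRoot? solution-or-root)
          (ℕ.+-monoʳ-≤ (count IsSolution?) #roots≤deg)))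

    solutions : Σ (Fin m → Carrier) λ x → Injective _≡_ _≈_ x × (∀ i → pow (x i) m ≈ c)
    solutions =
      let (f , f-injective , solves) = count-witnesses IsSolution? m m≤#solutions
      in enum ∘ f , (λ eq → f-injective (enum-injective _ _ eq)) , solves

  pow-roots : ∀ {D m c} → 1 ≤ D → pow c D ≈ 1# → HasCard (suc (D ℕ.* m)) →
              Σ (Fin m → Carrier) λ x → Injective _≡_ _≈_ x × (∀ i → pow (x i) m ≈ c)
  pow-roots {m = zero}            _ _    _    = (λ ()) , (λ {}) , (λ ())
  pow-roots {suc D′} {suc m′} _ c^D≈1 card = PowerEquation.solutions {D′} {m′} c^D≈1 card

module ReciprocalIdentity {c ℓ} (R : CommutativeRing c ℓ) (isField : FF.IsField R)
                          (q : ℕ) (d : ℕ) .{{_ : NonZero d}} (ε : FF.Carrier R) (k : ℕ)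
                          {t : ℕ} (L : FF.Poly R t) (t<m : t < FF.WithQ.WithD.m R q d ε k) where
  open FF R
  open CommutativeRing R hiding (Carrier; _≈_; _+_; _*_; 0#; 1#; zero)
  open WithQ q
  open WithD d ε k
  open Polynomials R
  open Coefficients R
  open Fields R isField
  open import Algebra.Properties.Ring ring using (-1*x≈-x)
  open import Relation.Binary.Reasoning.Setoid setoid

  εᵏ : Carrier
  εᵏ = pow ε k

  -- Coefficient of X^j (j < m) in lam·X^τ·L(X) reduced modulo X^m − εᵏ; since τ + t < 2m,
  -- only the terms of degree j and m + j contribute.
  reduced : ℕ → Carrier → ℕ → Carrier
  reduced τ lam j = lam * (shift τ (coeff L) j + εᵏ * shift τ (coeff L) (m ℕ.+ j))

  CoeffIdent : ℕ → Carrier → Set ℓ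
  CoeffIdent τ lam = ∀ j → j < m → coeff (tilde L) j ≈ reduced τ lam j

  eval-reduced : ∀ τ lam x → τ < m → pow x m ≈ εᵏ →
                 (lam * pow x τ) * eval L x ≈ evalUpTo m (reduced τ lam) x
  eval-reduced τ lam x τ<m xᵐ≈εᵏ = begin
    (lam * pow x τ) * eval L x                       ≈⟨ *-assoc lam _ _ ⟩
    lam * (pow x τ * eval L x)                       ≈⟨ *-congˡ (*-congˡ (eval≈evalUpTo L x t<m)) ⟩
    lam * (pow x τ * evalUpTo m (coeff L) x)         ≈⟨ *-congˡ (evalUpTo-shift τ m (coeff L) x) ⟩
    lam * evalUpTo (τ ℕ.+ m) XᵗL x                   ≈⟨ *-congˡ (evalUpTo-extend XᵗL x τ+m≤m+m XᵗL-beyond) ⟨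
    lam * evalUpTo (m ℕ.+ m) XᵗL x                   ≈⟨ *-congˡ (evalUpTo-split m m XᵗL x) ⟩
    lam * (evalUpTo m XᵗL x + pow x m * evalUpTo m (XᵗL ∘ (m ℕ.+_)) x)
      ≈⟨ *-congˡ (+-congˡ (*-congʳ xᵐ≈εᵏ)) ⟩
    lam * (evalUpTo m XᵗL x + εᵏ * evalUpTo m (XᵗL ∘ (m ℕ.+_)) x)
      ≈⟨ *-congˡ (evalUpTo-linear m _ _ εᵏ x) ⟩
    lam * evalUpTo m (λ j → XᵗL j + εᵏ * XᵗL (m ℕ.+ j)) x
      ≈⟨ *-distribˡ-evalUpTo m _ lam x ⟩
    evalUpTo m (reduced τ lam) x                     ∎
    where
    XᵗL : ℕ → Carrier
    XᵗL = shift τ (coeff L)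
    τ+m≤m+m : τ ℕ.+ m ≤ m ℕ.+ m
    τ+m≤m+m = ℕ.+-monoˡ-≤ m (ℕ.<⇒≤ τ<m)
    XᵗL-beyond : ∀ j → τ ℕ.+ m ≤ j → XᵗL j ≈ 0#
    XᵗL-beyond j τ+m≤j = reflexive (≡.trans (shift-≥ τ (coeff L) j (ℕ.≤-trans (ℕ.m≤m+n τ m) τ+m≤j))
      (coeff-≥ L (j ∸ τ) (ℕ.≤-trans t<m (ℕ.m+n≤o⇒m≤o∸n m (ℕ.≤-trans (ℕ.≤-reflexive (ℕ.+-comm m τ)) τ+m≤j)))))

  CoeffIdent⇒Ident : ∀ τ lam → τ < m → CoeffIdent τ lam → Ident L τ lam
  CoeffIdent⇒Ident τ lam τ<m coeffs x (_ , xᵐ≈εᵏ) = begin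
    eval (tilde L) x                      ≈⟨ eval≈evalUpTo (tilde L) x t<m ⟩
    evalUpTo m (coeff (tilde L)) x        ≈⟨ evalUpTo-cong m x coeffs ⟩
    evalUpTo m (reduced τ lam) x          ≈⟨ eval-reduced τ lam x τ<m xᵐ≈εᵏ ⟨
    (lam * pow x τ) * eval L x            ∎

  -- Both sides are polynomials with m coefficients, agreeing on the m points of A_k.
  Ident⇒CoeffIdent : (p : Fin m → Carrier) → Injective _≡_ _≈_ p → (∀ i → InA (p i)) →
                     ∀ τ lam → τ < m → Ident L τ lam → CoeffIdent τ lam
  Ident⇒CoeffIdent p p-injective p∈A τ lam τ<m ident j j<m =
    x∙y⁻¹≈ε⇒x≈y _ _ (trans (+-congˡ (sym (-1*x≈-x _))) (roots⇒coeffs≈0 m difference p p-injective roots j j<m))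
    where
    open import Algebra.Properties.Group +-group using (x∙y⁻¹≈ε⇒x≈y)
    difference : ℕ → Carrier
    difference j = coeff (tilde L) j + (- 1#) * reduced τ lam j
    roots : ∀ i → evalUpTo m difference (p i) ≈ 0#
    roots i = begin
      evalUpTo m difference x
        ≈⟨ evalUpTo-linear m _ _ (- 1#) x ⟨
      evalUpTo m (coeff (tilde L)) x + (- 1#) * evalUpTo m (reduced τ lam) x
        ≈⟨ +-cong (sym (eval≈evalUpTo (tilde L) x t<m)) (-1*x≈-x _) ⟩
      eval (tilde L) x - evalUpTo m (reduced τ lam) x
        ≈⟨ +-congʳ (trans (ident x (p∈A i)) (eval-reduced τ lam x τ<m (proj₂ (p∈A i)))) ⟩
      evalUpTo m (reduced τ lam) x - evalUpTo m (reduced τ lam) x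
        ≈⟨ -‿inverseʳ _ ⟩
      0#                                                                    ∎
      where x = p i

  Ident⇔CoeffIdent : (p : Fin m → Carrier) → Injective _≡_ _≈_ p → (∀ i → InA (p i)) →
                     ∀ τ lam → τ < m → Ident L τ lam ⇔ CoeffIdent τ lam
  Ident⇔CoeffIdent p p-injective p∈A τ lam τ<m =
    mk⇔ (Ident⇒CoeffIdent p p-injective p∈A τ lam τ<m) (CoeffIdent⇒Ident τ lam τ<m)

  conj-≉0 : ∀ {x} → ¬ (x ≈ 0#) → ¬ (conj x ≈ 0#)
  conj-≉0 = pow-≉0 q

  InMu⇒≉0 : ∀ {x} → InMu x → ¬ (x ≈ 0#)
  InMu⇒≉0 x^[q+1]≈1 x≈0 = 1≉0 (trans (sym x^[q+1]≈1) (trans (*-congʳ x≈0) (zeroˡ _)))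

  reduced-≥ : ∀ τ lam j → τ ≤ j → reduced τ lam j ≈ lam * coeff L (j ∸ τ)
  reduced-≥ τ lam j τ≤j = *-congˡ (begin
    shift τ (coeff L) j + εᵏ * shift τ (coeff L) (m ℕ.+ j)
      ≈⟨ +-cong (reflexive (shift-≥ τ (coeff L) j τ≤j)) (*-congˡ (reflexive (shift-≥ τ (coeff L) (m ℕ.+ j) τ≤m+j))) ⟩
    coeff L (j ∸ τ) + εᵏ * coeff L (m ℕ.+ j ∸ τ)
      ≈⟨ +-congˡ (trans (*-congˡ (reflexive (coeff-≥ L _ t<m+j-τ))) (zeroʳ εᵏ)) ⟩
    coeff L (j ∸ τ) + 0#
      ≈⟨ +-identityʳ _ ⟩
    coeff L (j ∸ τ) ∎)
    where
    τ≤m+j : τ ≤ m ℕ.+ j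
    τ≤m+j = ℕ.≤-trans τ≤j (ℕ.m≤n+m j m)
    t<m+j-τ : t < m ℕ.+ j ∸ τ
    t<m+j-τ = ℕ.≤-trans t<m (ℕ.≤-trans (ℕ.m≤m+n m (j ∸ τ)) (ℕ.≤-reflexive (≡.sym (ℕ.+-∸-assoc m τ≤j))))

  reduced-< : ∀ τ lam j → j < τ → τ ≤ m → reduced τ lam j ≈ (lam * εᵏ) * coeff L ((m ∸ τ) ℕ.+ j)
  reduced-< τ lam j j<τ τ≤m = begin
    lam * (shift τ (coeff L) j + εᵏ * shift τ (coeff L) (m ℕ.+ j))
      ≈⟨ *-congˡ (+-cong (reflexive (shift-< τ (coeff L) j j<τ)) (*-congˡ (reflexive m+j-τ))) ⟩
    lam * (0# + εᵏ * coeff L ((m ∸ τ) ℕ.+ j))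
      ≈⟨ trans (*-congˡ (+-identityˡ _)) (sym (*-assoc lam εᵏ _)) ⟩
    (lam * εᵏ) * coeff L ((m ∸ τ) ℕ.+ j) ∎
    where
    m+j-τ : shift τ (coeff L) (m ℕ.+ j) ≡ coeff L ((m ∸ τ) ℕ.+ j)
    m+j-τ = ≡.trans (shift-≥ τ (coeff L) (m ℕ.+ j) (ℕ.≤-trans τ≤m (ℕ.m≤m+n m j))) (≡.cong (coeff L) (ℕ.+-∸-comm j τ≤m))

  CoeffIdent⇒τ-range : HasDegree t L → ¬ (L zero ≈ 0#) →
                       ∀ τ lam → 0 < τ → τ < m → CoeffIdent τ lam → m ∸ t ≤ τ × τ ≤ t
  CoeffIdent⇒τ-range deg≉0 L0≉0 τ lam 0<τ τ<m coeffs = m∸t≤τ , τ≤t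
    where
    m∸t≤τ : m ∸ t ≤ τ
    m∸t≤τ with m ∸ t ℕ.≤? τ
    ... | yes m∸t≤τ = m∸t≤τ
    ... | no  m∸t≰τ = contradiction (begin
      conj (coeff L t)                           ≡⟨ coeff-tilde q L 0 z≤n ⟨
      coeff (tilde L) 0                          ≈⟨ coeffs 0 (ℕ.<-trans 0<τ τ<m) ⟩
      reduced τ lam 0                            ≈⟨ reduced-< τ lam 0 0<τ (ℕ.<⇒≤ τ<m) ⟩
      (lam * εᵏ) * coeff L ((m ∸ τ) ℕ.+ 0)       ≈⟨ trans (*-congˡ (reflexive (coeff-≥ L _ t<m-τ))) (zeroʳ _) ⟩
      0#                                         ∎) (conj-≉0 (HasDegree⇒coeff≉0 L deg≉0))
      where
      t<m-τ : t < (m ∸ τ) ℕ.+ 0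
      t<m-τ = ℕ.≤-trans (ℕ.m+n≤o⇒m≤o∸n (suc t) (ℕ.≤-trans (ℕ.≤-reflexive (≡.cong suc (ℕ.+-comm t τ)))
                (ℕ.m≤o∸n⇒m+n≤o (suc τ) (ℕ.<⇒≤ t<m) (ℕ.≰⇒> m∸t≰τ))))
              (ℕ.≤-reflexive (≡.sym (ℕ.+-identityʳ _)))
    τ≤t : τ ≤ t
    τ≤t with τ ℕ.≤? t
    ... | yes τ≤t = τ≤t
    ... | no  τ≰t = contradiction (begin
      conj (coeff L 0)                           ≡⟨ ≡.cong (conj ∘ coeff L) (ℕ.n∸n≡0 t) ⟨
      conj (coeff L (t ∸ t))                     ≡⟨ coeff-tilde q L t ℕ.≤-refl ⟨
      coeff (tilde L) t                          ≈⟨ coeffs t t<m ⟩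
      reduced τ lam t                            ≈⟨ reduced-< τ lam t (ℕ.≰⇒> τ≰t) (ℕ.<⇒≤ τ<m) ⟩
      (lam * εᵏ) * coeff L ((m ∸ τ) ℕ.+ t)       ≈⟨ trans (*-congˡ (reflexive (coeff-≥ L _ (ℕ.+-monoˡ-≤ t (ℕ.m<n⇒0<n∸m τ<m))))) (zeroʳ _) ⟩
      0#                                         ∎) (conj-≉0 (≡.subst (λ u → ¬ (u ≈ 0#)) (≡.sym (coeff-toℕ L zero)) L0≉0))

  CoeffIdent0⇔Reciprocal : ∀ lam → CoeffIdent 0 lam ⇔ Reciprocal q t lam (coeff L)
  CoeffIdent0⇔Reciprocal lam = mk⇔
    (λ coeffs j j≤t → begin
      conj (coeff L (t ∸ j))          ≡⟨ coeff-tilde q L j j≤t ⟨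
      coeff (tilde L) j               ≈⟨ coeffs j (ℕ.≤-<-trans j≤t t<m) ⟩
      reduced 0 lam j                 ≈⟨ reduced-≥ 0 lam j z≤n ⟩
      lam * coeff L j                 ∎)
    (λ rec j _ → from-reciprocal rec j)
    where
    from-reciprocal : Reciprocal q t lam (coeff L) → ∀ j → coeff (tilde L) j ≈ reduced 0 lam j
    from-reciprocal rec j with j ℕ.≤? t
    ... | yes j≤t = trans (reflexive (coeff-tilde q L j j≤t)) (trans (rec j j≤t) (sym (reduced-≥ 0 lam j z≤n)))
    ... | no  j≰t = trans (reflexive (coeff-≥ (tilde L) j (ℕ.≰⇒> j≰t)))
                      (sym (trans (reduced-≥ 0 lam j z≤n) (trans (*-congˡ (reflexive (coeff-≥ L j (ℕ.≰⇒> j≰t)))) (zeroʳ lam))))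

  conj-0# : 1 ≤ q → conj 0# ≈ 0#
  conj-0# 1≤q = trans (reflexive (≡.cong (pow 0#) (≡.sym (ℕ.m+[n∸m]≡n 1≤q)))) (zeroˡ _)

  module Split (τ : ℕ) (lam : Carrier) (m∸t≤τ : m ∸ t ≤ τ) (τ≤t : τ ≤ t) where
    a b m′ : ℕ
    a  = t ∸ τ
    b  = τ ℕ.+ t ∸ m
    m′ = m ∸ τ

    τ<m : τ < m
    τ<m = ℕ.≤-<-trans τ≤t t<m

    τ+a≡t : τ ℕ.+ a ≡ t
    τ+a≡t = ℕ.m+[n∸m]≡n τ≤t

    m′+b≡t : m′ ℕ.+ b ≡ t
    m′+b≡t = ℕ.+-cancelˡ-≡ τ _ _ (≡.trans (≡.sym (ℕ.+-assoc τ m′ b))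
               (≡.trans (≡.cong (ℕ._+ b) (ℕ.m+[n∸m]≡n (ℕ.<⇒≤ τ<m))) (ℕ.m+[n∸m]≡n m≤τ+t)))
      where
      m≤τ+t : m ≤ τ ℕ.+ t
      m≤τ+t = ℕ.≤-trans (ℕ.m≤n+m∸n m t) (ℕ.≤-trans (ℕ.+-monoʳ-≤ t m∸t≤τ) (ℕ.≤-reflexive (ℕ.+-comm t τ)))

    a<m′ : a < m′
    a<m′ = ℕ.∸-monoˡ-< t<m τ≤t

    b<τ : b < τ
    b<τ = ℕ.+-cancelˡ-< m′ b τ (ℕ.≤-trans (ℕ.≤-reflexive (≡.cong suc m′+b≡t))
            (ℕ.≤-trans t<m (ℕ.≤-reflexive (≡.trans (≡.sym (ℕ.m+[n∸m]≡n (ℕ.<⇒≤ τ<m))) (ℕ.+-comm τ m′)))))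

    t∸j≡m′+[b∸j] : ∀ {j} → j ≤ b → t ∸ j ≡ m′ ℕ.+ (b ∸ j)
    t∸j≡m′+[b∸j] {j} j≤b = ≡.trans (≡.cong (_∸ j) (≡.sym m′+b≡t)) (ℕ.+-∸-assoc m′ j≤b)

    Gap : Set ℓ
    Gap = ∀ i → a < i → i < m′ → coeff L i ≈ 0#

    -- Coefficientwise form of L = P + X^m′·Q with P̃ = λP and Q̃ = λεᵏQ.
    SplitIdent : Set ℓ
    SplitIdent = Reciprocal q a lam (coeff L) × Gap × Reciprocal q b (lam * εᵏ) (coeff L ∘ (m′ ℕ.+_))

    CoeffIdent⇒SplitIdent : ¬ (lam ≈ 0#) → CoeffIdent τ lam → SplitIdent
    CoeffIdent⇒SplitIdent lam≉0 coeffs = low , gap , high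
      where
      at-τ+ : ∀ i → i < m′ → coeff (tilde L) (τ ℕ.+ i) ≈ lam * coeff L i
      at-τ+ i i<m′ = trans (coeffs (τ ℕ.+ i) τ+i<m)
        (trans (reduced-≥ τ lam (τ ℕ.+ i) (ℕ.m≤m+n τ i)) (reflexive (≡.cong (λ n → lam * coeff L n) (ℕ.m+n∸m≡n τ i))))
        where
        τ+i<m : τ ℕ.+ i < m
        τ+i<m = ℕ.<-≤-trans (ℕ.+-monoʳ-< τ i<m′) (ℕ.≤-reflexive (ℕ.m+[n∸m]≡n (ℕ.<⇒≤ τ<m)))

      low : Reciprocal q a lam (coeff L)
      low i i≤a = begin
        conj (coeff L (a ∸ i))              ≡⟨ ≡.cong (conj ∘ coeff L) (ℕ.∸-+-assoc t τ i) ⟩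
        conj (coeff L (t ∸ (τ ℕ.+ i)))      ≡⟨ coeff-tilde q L (τ ℕ.+ i) τ+i≤t ⟨
        coeff (tilde L) (τ ℕ.+ i)           ≈⟨ at-τ+ i (ℕ.≤-<-trans i≤a a<m′) ⟩
        lam * coeff L i                     ∎
        where
        τ+i≤t : τ ℕ.+ i ≤ t
        τ+i≤t = ℕ.≤-trans (ℕ.+-monoʳ-≤ τ i≤a) (ℕ.≤-reflexive τ+a≡t)

      gap : Gap
      gap i a<i i<m′ = x*y≈0⇒y≈0 lam≉0 (begin
        lam * coeff L i                     ≈⟨ at-τ+ i i<m′ ⟨
        coeff (tilde L) (τ ℕ.+ i)           ≡⟨ coeff-≥ (tilde L) (τ ℕ.+ i) t<τ+i ⟩
        0#                                  ∎)
        where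
        t<τ+i : t < τ ℕ.+ i
        t<τ+i = ℕ.≤-trans (ℕ.≤-reflexive (≡.cong suc (≡.sym τ+a≡t))) (ℕ.+-monoʳ-< τ a<i)

      high : Reciprocal q b (lam * εᵏ) (coeff L ∘ (m′ ℕ.+_))
      high j j≤b = begin
        conj (coeff L (m′ ℕ.+ (b ∸ j)))     ≡⟨ ≡.cong (conj ∘ coeff L) (t∸j≡m′+[b∸j] j≤b) ⟨
        conj (coeff L (t ∸ j))              ≡⟨ coeff-tilde q L j (ℕ.≤-trans (ℕ.<⇒≤ j<τ) τ≤t) ⟨
        coeff (tilde L) j                   ≈⟨ coeffs j (ℕ.<-trans j<τ τ<m) ⟩
        reduced τ lam j                     ≈⟨ reduced-< τ lam j j<τ (ℕ.<⇒≤ τ<m) ⟩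
        (lam * εᵏ) * coeff L (m′ ℕ.+ j)     ∎
        where
        j<τ : j < τ
        j<τ = ℕ.≤-<-trans j≤b b<τ

    CoeffIdent-below-τ : 1 ≤ q → Gap → Reciprocal q b (lam * εᵏ) (coeff L ∘ (m′ ℕ.+_)) →
                         ∀ j → j < τ → coeff (tilde L) j ≈ reduced τ lam j
    CoeffIdent-below-τ 1≤q gap high j j<τ with j ℕ.≤? b
    ... | yes j≤b = begin
      coeff (tilde L) j                     ≡⟨ coeff-tilde q L j j≤t ⟩
      conj (coeff L (t ∸ j))                ≡⟨ ≡.cong (conj ∘ coeff L) (t∸j≡m′+[b∸j] j≤b) ⟩
      conj (coeff L (m′ ℕ.+ (b ∸ j)))       ≈⟨ high j j≤b ⟩
      (lam * εᵏ) * coeff L (m′ ℕ.+ j)       ≈⟨ reduced-< τ lam j j<τ (ℕ.<⇒≤ τ<m) ⟨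
      reduced τ lam j                       ∎
      where
      j≤t : j ≤ t
      j≤t = ℕ.≤-trans (ℕ.<⇒≤ j<τ) τ≤t
    ... | no  j≰b = begin
      coeff (tilde L) j                     ≡⟨ coeff-tilde q L j j≤t ⟩
      conj (coeff L (t ∸ j))                ≈⟨ pow-congˡ q (gap (t ∸ j) (ℕ.∸-monoʳ-< j<τ τ≤t) t∸j<m′) ⟩
      conj 0#                               ≈⟨ conj-0# 1≤q ⟩
      0#                                    ≈⟨ trans (*-congˡ (reflexive (coeff-≥ L (m′ ℕ.+ j) t<m′+j))) (zeroʳ _) ⟨
      (lam * εᵏ) * coeff L (m′ ℕ.+ j)       ≈⟨ reduced-< τ lam j j<τ (ℕ.<⇒≤ τ<m) ⟨
      reduced τ lam j                       ∎
      where
      j≤t : j ≤ t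
      j≤t = ℕ.≤-trans (ℕ.<⇒≤ j<τ) τ≤t
      b<j : b < j
      b<j = ℕ.≰⇒> j≰b
      t∸j<m′ : t ∸ j < m′
      t∸j<m′ = ℕ.<-≤-trans (ℕ.∸-monoʳ-< b<j j≤t) (ℕ.≤-reflexive (≡.trans (≡.cong (_∸ b) (≡.sym m′+b≡t)) (ℕ.m+n∸n≡m m′ b)))
      t<m′+j : t < m′ ℕ.+ j
      t<m′+j = ℕ.≤-trans (ℕ.≤-reflexive (≡.cong suc (≡.sym m′+b≡t))) (ℕ.+-monoʳ-< m′ b<j)

    CoeffIdent-from-τ : Gap → Reciprocal q a lam (coeff L) →
                        ∀ j → τ ≤ j → j < m → coeff (tilde L) j ≈ reduced τ lam j
    CoeffIdent-from-τ gap low j τ≤j j<m with j ℕ.≤? t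
    ... | yes j≤t = begin
      coeff (tilde L) j                     ≡⟨ coeff-tilde q L j j≤t ⟩
      conj (coeff L (t ∸ j))                ≡⟨ ≡.cong (conj ∘ coeff L) t∸j≡a∸[j∸τ] ⟩
      conj (coeff L (a ∸ (j ∸ τ)))          ≈⟨ low (j ∸ τ) (ℕ.∸-monoˡ-≤ τ j≤t) ⟩
      lam * coeff L (j ∸ τ)                 ≈⟨ reduced-≥ τ lam j τ≤j ⟨
      reduced τ lam j                       ∎
      where
      t∸j≡a∸[j∸τ] : t ∸ j ≡ a ∸ (j ∸ τ)
      t∸j≡a∸[j∸τ] = ≡.trans (≡.cong (t ∸_) (≡.sym (ℕ.m+[n∸m]≡n τ≤j))) (≡.sym (ℕ.∸-+-assoc t τ (j ∸ τ)))
    ... | no  j≰t = begin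
      coeff (tilde L) j                     ≡⟨ coeff-≥ (tilde L) j (ℕ.≰⇒> j≰t) ⟩
      0#                                    ≈⟨ trans (*-congˡ (gap (j ∸ τ) (ℕ.∸-monoˡ-< (ℕ.≰⇒> j≰t) τ≤t) (ℕ.∸-monoˡ-< j<m τ≤j))) (zeroʳ lam) ⟨
      lam * coeff L (j ∸ τ)                 ≈⟨ reduced-≥ τ lam j τ≤j ⟨
      reduced τ lam j                       ∎

    SplitIdent⇒CoeffIdent : 1 ≤ q → SplitIdent → CoeffIdent τ lam
    SplitIdent⇒CoeffIdent 1≤q (low , gap , high) j j<m with j ℕ.<? τ
    ... | yes j<τ = CoeffIdent-below-τ 1≤q gap high j j<τ
    ... | no  j≮τ = CoeffIdent-from-τ gap low j (ℕ.≮⇒≥ j≮τ) j<m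

    Decomposition : Set (c ⊔ ℓ)
    Decomposition = Σ (Poly a) λ P → Σ (Poly b) λ Q →
                      HasDegree a P × (∀ i → tilde P i ≈ lam * P i)
                    × HasDegree b Q × (∀ i → tilde Q i ≈ (lam * εᵏ) * Q i)
                    × (∀ j → coeff L j ≈ coeff P j + coeffShift m′ Q j)

    SplitIdent⇒Decomposition : HasDegree t L → ¬ (L zero ≈ 0#) → SplitIdent → Decomposition
    SplitIdent⇒Decomposition deg≉0 L0≉0 (low , gap , high) =
      P , Q , P-degree , P-reciprocal , Q-degree , Q-reciprocal , L≈P+XᵐQ
      where
      P : Poly a
      P = coeff L ∘ toℕ
      Q : Poly b
      Q = coeff L ∘ (m′ ℕ.+_) ∘ toℕ

      P-degree : HasDegree a P
      P-degree P[a]≈0 = conj-≉0 (≡.subst (λ u → ¬ (u ≈ 0#)) (≡.sym (coeff-toℕ L zero)) L0≉0) (begin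
        conj (coeff L 0)                    ≡⟨ ≡.cong (conj ∘ coeff L) (ℕ.n∸n≡0 a) ⟨
        conj (coeff L (a ∸ a))              ≈⟨ low a ℕ.≤-refl ⟩
        lam * coeff L a                     ≡⟨ ≡.cong (λ n → lam * coeff L n) (Fin.toℕ-fromℕ a) ⟨
        lam * P (fromℕ a)                   ≈⟨ trans (*-congˡ P[a]≈0) (zeroʳ lam) ⟩
        0#                                  ∎)

      Q-degree : HasDegree b Q
      Q-degree Q[b]≈0 = HasDegree⇒coeff≉0 L deg≉0
        (trans (reflexive (≡.cong (coeff L) (≡.sym (≡.trans (≡.cong (m′ ℕ.+_) (Fin.toℕ-fromℕ b)) m′+b≡t)))) Q[b]≈0)

      P-reciprocal : ∀ i → tilde P i ≈ lam * P i
      P-reciprocal = Equivalence.from (tilde≈*⇔Reciprocal q P lam)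
        (Reciprocal-cong q (λ j j≤a → reflexive (≡.sym (coeff-tabulate a (coeff L) j j≤a))) low)

      Q-reciprocal : ∀ i → tilde Q i ≈ (lam * εᵏ) * Q i
      Q-reciprocal = Equivalence.from (tilde≈*⇔Reciprocal q Q (lam * εᵏ))
        (Reciprocal-cong q (λ j j≤b → reflexive (≡.sym (coeff-tabulate b (coeff L ∘ (m′ ℕ.+_)) j j≤b))) high)

      L≈P+XᵐQ : ∀ j → coeff L j ≈ coeff P j + coeffShift m′ Q j
      L≈P+XᵐQ j with j ℕ.≤? a | m′ ℕ.≤? j
      ... | yes j≤a | _ = sym (trans (+-cong (reflexive (coeff-tabulate a (coeff L) j j≤a))
                                             (reflexive (coeffShift-< m′ Q j (ℕ.≤-<-trans j≤a a<m′))))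
                                     (+-identityʳ _))
      ... | no j≰a | no m′≰j = trans (gap j (ℕ.≰⇒> j≰a) j<m′)
        (sym (trans (+-cong (reflexive (coeff-≥ P j (ℕ.≰⇒> j≰a))) (reflexive (coeffShift-< m′ Q j j<m′))) (+-identityʳ _)))
        where
        j<m′ : j < m′
        j<m′ = ℕ.≰⇒> m′≰j
      ... | no j≰a | yes m′≤j = sym (trans (+-cong (reflexive (coeff-≥ P j (ℕ.≰⇒> j≰a)))
                                                  (reflexive (coeffShift-≥ m′ Q j m′≤j)))
                                          (trans (+-identityˡ _) upper))
        where
        upper : coeff Q (j ∸ m′) ≈ coeff L j
        upper with j ∸ m′ ℕ.≤? b
        ... | yes j∸m′≤b = reflexive (≡.trans (coeff-tabulate b (coeff L ∘ (m′ ℕ.+_)) (j ∸ m′) j∸m′≤b)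
                                              (≡.cong (coeff L) (ℕ.m+[n∸m]≡n m′≤j)))
        ... | no  j∸m′≰b = trans (reflexive (coeff-≥ Q (j ∸ m′) (ℕ.≰⇒> j∸m′≰b))) (sym (reflexive (coeff-≥ L j t<j)))
          where
          t<j : t < j
          t<j = ℕ.≤-trans (ℕ.≤-reflexive (≡.cong suc (≡.sym m′+b≡t)))
                  (ℕ.≤-trans (ℕ.+-monoʳ-< m′ (ℕ.≰⇒> j∸m′≰b)) (ℕ.≤-reflexive (ℕ.m+[n∸m]≡n m′≤j)))

    Decomposition⇒SplitIdent : Decomposition → SplitIdent
    Decomposition⇒SplitIdent (P , Q , _ , P-reciprocal , _ , Q-reciprocal , L≈P+XᵐQ) =
      Reciprocal-cong q L-low (Equivalence.to (tilde≈*⇔Reciprocal q P lam) P-reciprocal) ,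
      L-gap ,
      Reciprocal-cong q (λ j _ → L-high j) (Equivalence.to (tilde≈*⇔Reciprocal q Q (lam * εᵏ)) Q-reciprocal)
      where
      L-low : ∀ j → j ≤ a → coeff P j ≈ coeff L j
      L-low j j≤a = sym (trans (L≈P+XᵐQ j)
        (trans (+-congˡ (reflexive (coeffShift-< m′ Q j (ℕ.≤-<-trans j≤a a<m′)))) (+-identityʳ _)))
      L-gap : Gap
      L-gap j a<j j<m′ = trans (L≈P+XᵐQ j)
        (trans (+-cong (reflexive (coeff-≥ P j a<j)) (reflexive (coeffShift-< m′ Q j j<m′))) (+-identityʳ _))
      L-high : ∀ j → coeff Q j ≈ coeff L (m′ ℕ.+ j)
      L-high j = sym (trans (L≈P+XᵐQ (m′ ℕ.+ j)) (trans (+-cong (reflexive (coeff-≥ P _ a<m′+j))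
        (reflexive (≡.trans (coeffShift-≥ m′ Q (m′ ℕ.+ j) (ℕ.m≤m+n m′ j)) (≡.cong (coeff Q) (ℕ.m+n∸m≡n m′ j)))))
        (+-identityˡ _)))
        where
        a<m′+j : a < m′ ℕ.+ j
        a<m′+j = ℕ.<-≤-trans a<m′ (ℕ.m≤m+n m′ j)

    CoeffIdent⇔Decomposition : 1 ≤ q → HasDegree t L → ¬ (L zero ≈ 0#) → ¬ (lam ≈ 0#) →
                               CoeffIdent τ lam ⇔ Decomposition
    CoeffIdent⇔Decomposition 1≤q deg≉0 L0≉0 lam≉0 = mk⇔
      (SplitIdent⇒Decomposition deg≉0 L0≉0 ∘ CoeffIdent⇒SplitIdent lam≉0)
      (SplitIdent⇒CoeffIdent 1≤q ∘ Decomposition⇒SplitIdent)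

primePower⇒2≤ : ∀ {q} → IsPrimePower q → 2 ≤ q
primePower⇒2≤ (p , e , prime {{p-nontrivial}} _ , 1≤e , q≡pᵉ) =
  ℕ.≤-trans (ℕ.nonTrivial⇒n>1 p {{p-nontrivial}})
    (ℕ.≤-trans (ℕ.≤-reflexive (≡.sym (ℕ.*-identityʳ p)))
      (ℕ.≤-trans (ℕ.^-monoʳ-≤ p {{ℕ.nonTrivial⇒nonZero p {{p-nontrivial}}}} 1≤e) (ℕ.≤-reflexive (≡.sym q≡pᵉ))))

-- q² = 1 + (q − 1)(q + 1) with q + 1 = m·d, written for q = suc q₁.
square≡1+[d*[q-1]]*m : ∀ q₁ d m → m ℕ.* d ≡ suc (suc q₁) → suc q₁ ^ 2 ≡ suc (d ℕ.* q₁ ℕ.* m)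
square≡1+[d*[q-1]]*m q₁ d m md≡q+1 =
  ≡.trans (solve 1 (λ x → (con 1 :+ x) :^ 2 := con 1 :+ x :* (con 2 :+ x)) ≡.refl q₁)
    (≡.cong suc (≡.trans (≡.cong (q₁ ℕ.*_) (≡.sym md≡q+1))
      (solve 3 (λ x d m → x :* (m :* d) := d :* x :* m) ≡.refl q₁ d m)))
  where open +-*-Solver

module _ {c ℓ} (R : CommutativeRing c ℓ) where
  open FF R
  open CommutativeRing R hiding (Carrier; _≈_; _+_; _*_; 0#; 1#; zero)
  open Polynomials R
  open import Relation.Binary.Reasoning.Setoid setoid

  A-points : IsField → ∀ q → 2 ≤ q → HasCard (q ^ 2) → let open WithQ q in
             ∀ d .{{_ : NonZero d}} → d ∣ suc q → ∀ ε → pow ε d ≈ 1# → ∀ k → let open WithD d ε k in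
             Σ (Fin m → Carrier) λ x → Injective _≡_ _≈_ x × (∀ i → InA (x i))
  A-points isField (suc q₁) (s≤s 1≤q₁) card d d∣q+1 ε εᵈ≈1 k =
    let (x , x-injective , xᵐ≈εᵏ) = Fields.pow-roots R isField 1≤D εᵏᴰ≈1 (≡.subst HasCard q²≡1+Dm card)
    in x , x-injective , λ i → yᵐ≈εᵏ⇒y∈μ (x i) (xᵐ≈εᵏ i) , xᵐ≈εᵏ i
    where
    open WithQ (suc q₁)
    open WithD d ε k
    D : ℕ
    D = d ℕ.* q₁
    md≡q+1 : m ℕ.* d ≡ suc (suc q₁)
    md≡q+1 = m/n*n≡m d∣q+1
    1≤D : 1 ≤ D
    1≤D = ℕ.*-mono-≤ (ℕ.>-nonZero⁻¹ d) 1≤q₁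
    q²≡1+Dm : suc q₁ ^ 2 ≡ suc (D ℕ.* m)
    q²≡1+Dm = square≡1+[d*[q-1]]*m q₁ d m md≡q+1
    εᵏᵈ≈1 : pow (pow ε k) d ≈ 1#
    εᵏᵈ≈1 = begin
      pow (pow ε k) d           ≈⟨ pow-assocʳ ε k d ⟩
      pow ε (k ℕ.* d)           ≡⟨ ≡.cong (pow ε) (ℕ.*-comm k d) ⟩
      pow ε (d ℕ.* k)           ≈⟨ pow-assocʳ ε d k ⟨
      pow (pow ε d) k           ≈⟨ pow-congˡ k εᵈ≈1 ⟩
      pow 1# k                  ≈⟨ pow-1# k ⟩
      1#                        ∎
    εᵏᴰ≈1 : pow (pow ε k) D ≈ 1#
    εᵏᴰ≈1 = trans (sym (pow-assocʳ (pow ε k) d q₁)) (trans (pow-congˡ q₁ εᵏᵈ≈1) (pow-1# q₁))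
    yᵐ≈εᵏ⇒y∈μ : ∀ y → pow y m ≈ pow ε k → InMu y
    yᵐ≈εᵏ⇒y∈μ y yᵐ≈εᵏ = begin
      pow y (suc (suc q₁))      ≡⟨ ≡.cong (pow y) md≡q+1 ⟨
      pow y (m ℕ.* d)           ≈⟨ pow-assocʳ y m d ⟨
      pow (pow y m) d           ≈⟨ pow-congˡ d yᵐ≈εᵏ ⟩
      pow (pow ε k) d           ≈⟨ εᵏᵈ≈1 ⟩
      1#                        ∎

lemma2p1 : ∀ {c ℓ : Level} (R : CommutativeRing c ℓ) → let open FF R in
    (q : ℕ) → IsPrimePower q → IsField → HasCard (q ^ 2) →
    let open WithQ q in
    (d : ℕ) .{{_ : NonZero d}} → d ∣ suc q →
    (ε : Carrier) → HasOrder ε d → (k : ℕ) → k < d →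
    let open WithD d ε k in
    (t : ℕ) (L : Poly t) → HasDegree t L → ¬ (L zero ≈ 0#) → t < m →
    (∀ x → InA x → ¬ (eval L x ≈ 0#)) →
    Conclusion t L
lemma2p1 R q q-primePower isField card d d∣q+1 ε (εᵈ≈1 , _) k _ t L deg≉0 L0≉0 t<m _ =
  part-i , part-ii , part-iii
  where
  open FF R
  open WithQ q
  open WithD d ε k
  open Coefficients R
  open ReciprocalIdentity R isField q d ε k L t<m
  2≤q : 2 ≤ q
  2≤q = primePower⇒2≤ q-primePower

  Ident⇔ : ∀ τ lam → τ < m → Ident L τ lam ⇔ CoeffIdent τ lam
  Ident⇔ = let (x , x-injective , x∈A) = A-points R isField q 2≤q card d d∣q+1 ε εᵈ≈1 k
           in Ident⇔CoeffIdent x x-injective x∈A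

  part-i : ∀ τ lam → τ < m → InMu lam → Ident L τ lam → τ ≡ 0 ⊎ (m ∸ t ≤ τ × τ ≤ t)
  part-i zero    lam _   _ _     = inj₁ ≡.refl
  part-i (suc τ) lam τ<m _ ident = inj₂ (CoeffIdent⇒τ-range deg≉0 L0≉0 (suc τ) lam (s≤s z≤n) τ<m
                                           (Equivalence.to (Ident⇔ (suc τ) lam τ<m) ident))

  part-ii : ∀ lam → InMu lam → Ident L 0 lam ⇔ (∀ i → tilde L i ≈ lam * L i)
  part-ii lam _ = ⇔.trans (Ident⇔ 0 lam (ℕ.≤-<-trans z≤n t<m))
                    (⇔.trans (CoeffIdent0⇔Reciprocal lam) (⇔.sym (tilde≈*⇔Reciprocal q L lam)))

  part-iii : ∀ τ lam → InMu lam → (m∸t≤τ : m ∸ t ≤ τ) (τ≤t : τ ≤ t) →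
             Ident L τ lam ⇔ Split.Decomposition τ lam m∸t≤τ τ≤t
  part-iii τ lam lam∈μ m∸t≤τ τ≤t = ⇔.trans (Ident⇔ τ lam (ℕ.≤-<-trans τ≤t t<m))
    (CoeffIdent⇔Decomposition (ℕ.<⇒≤ 2≤q) deg≉0 L0≉0 (InMu⇒≉0 lam∈μ))
    where open Split τ lam m∸t≤τ τ≤t
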